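{- Let $a,b,e\in\mathbb Z$ with $a\neq 0$ and $e>0$, and let $h_2(j)=aj^2+bj+e$ for $j\in\mathbb Z_{\geq 0}$, where it is assumed that $h_2(j)\geq 0$ for all $j\geq 0$. Put $\alpha=a/e$, $\beta=b/e$, $\Delta=b^2-4ae$ and $\Delta(\alpha,\beta)=(\alpha+\beta)^2-7\alpha-3\beta-\frac{7}{4}$. If $\alpha+\beta\geq 11$ and $\Delta\leq 0$, then $\Delta(\alpha,\beta)>\frac{1}{4}$. -}

module Defs where

open import Data.Nat using (ℕ; suc)
open import Data.Integer as ℤ using (ℤ; +_; -[1+_])
open import Data.Rational using (ℚ; _/_; 0ℚ)

-- Rational quotient x / y of two integers; the value for y = 0 is an
-- arbitrary junk value (0) and is never used (the statement assumes e > 0).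
_/ℤ_ : ℤ → ℤ → ℚ
x /ℤ (+ 0)      = 0ℚ
x /ℤ (+ suc n)  = x / suc n
x /ℤ -[1+ n ]   = (ℤ.- x) / suc n

h₂ : ℤ → ℤ → ℤ → ℕ → ℤ
h₂ a b e j = a ℤ.* (+ j) ℤ.* (+ j) ℤ.+ b ℤ.* (+ j) ℤ.+ e

disc : ℤ → ℤ → ℤ → ℤ
disc a b e = b ℤ.* b ℤ.- (+ 4) ℤ.* a ℤ.* e

{-# OPTIONS --safe #-}
-- Since e > 0, dividing Δ = b² − 4ae ≤ 0 by e² gives β² ≤ 4α.  Writing s = α + β,
--   Δ(α,β) = 9/4 + ½(4α − β²) + ½(β + 6)² + (s − 11)(s + 2),
-- and for s ≥ 11 every term after 9/4 is nonnegative, so Δ(α,β) ≥ 9/4.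
module Submission where

open import Defs
open import Data.Nat using (ℕ)
open import Data.Integer using (ℤ; +_)
open import Data.Rational using (ℚ; _/_; _+_; _-_; _*_; _≤_; _<_)
open import Relation.Binary.PropositionalEquality using (_≢_)

open import Data.Nat as ℕ using (suc)
import Data.Nat.Properties as ℕP
import Data.Integer as ℤ
import Data.Integer.Properties as ℤP
open import Data.Rational as Q using (0ℚ; -_; toℚᵘ)
import Data.Rational.Properties as QP
import Data.Rational.Unnormalised as U
import Data.Rational.Unnormalised.Properties as UP
open import Data.Rational.Solver using (module +-*-Solver)
open import Data.Sum using (inj₁; inj₂)
open import Data.Unit using (tt)
open import Relation.Nullary.Decidable using (toWitness)
open import Relation.Binary.PropositionalEquality using (_≡_; refl; sym; subst)

0≤p*q : ∀ {p q} → 0ℚ ≤ p → 0ℚ ≤ q → 0ℚ ≤ p * q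
0≤p*q {p} {q} 0≤p 0≤q = QP.nonNegative⁻¹ _ {{QP.nonNeg*nonNeg⇒nonNeg p {{Q.nonNegative 0≤p}} q {{Q.nonNegative 0≤q}}}}

0≤p*p : ∀ p → 0ℚ ≤ p * p
0≤p*p p with QP.≤-total 0ℚ p
... | inj₁ 0≤p = 0≤p*q 0≤p 0≤p
... | inj₂ p≤0 = QP.nonNegative⁻¹ _ {{QP.nonPos*nonPos⇒nonPos p {{Q.nonPositive p≤0}} p {{Q.nonPositive p≤0}}}}

p≤q⇒0≤q-p : ∀ {p q} → p ≤ q → 0ℚ ≤ q - p
p≤q⇒0≤q-p {p} {q} p≤q = subst (_≤ q - p) (QP.+-inverseʳ p) (QP.+-monoˡ-≤ (- p) p≤q)

disc≤0⇒b²e≤4ae² : ∀ a b e → + 0 ℤ.≤ e → disc a b e ℤ.≤ + 0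
                → b ℤ.* b ℤ.* e ℤ.≤ + 4 ℤ.* a ℤ.* (e ℤ.* e)
disc≤0⇒b²e≤4ae² a b e 0≤e Δ≤0 = begin
  b ℤ.* b ℤ.* e            ≤⟨ ℤP.*-monoʳ-≤-nonNeg e {{ℤ.nonNegative 0≤e}} (ℤP.i-j≤0⇒i≤j {b ℤ.* b} Δ≤0) ⟩
  + 4 ℤ.* a ℤ.* e ℤ.* e    ≡⟨ ℤP.*-assoc (+ 4 ℤ.* a) e e ⟩
  + 4 ℤ.* a ℤ.* (e ℤ.* e)  ∎
  where open ℤP.≤-Reasoning

disc≤0⇒β²≤4α : ∀ a b e → + 0 ℤ.< e → disc a b e ℤ.≤ + 0
             → (b /ℤ e) * (b /ℤ e) ≤ (+ 4 / 1) * (a /ℤ e)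
disc≤0⇒β²≤4α a b (+ 0) (ℤ.+<+ ()) _
disc≤0⇒β²≤4α a b (+ suc n) _ Δ≤0 = QP.toℚᵘ-cancel-≤ (begin
  toℚᵘ (β * β)                ≃⟨ QP.toℚᵘ-homo-* β β ⟩
  toℚᵘ β U.* toℚᵘ β           ≃⟨ UP.*-cong (QP.toℚᵘ-fromℚᵘ B) (QP.toℚᵘ-fromℚᵘ B) ⟩
  B U.* B                     ≤⟨ U.*≤* b²e≤4ae² ⟩
  toℚᵘ (+ 4 / 1) U.* A        ≃⟨ UP.*-congˡ {toℚᵘ (+ 4 / 1)} (UP.≃-sym (QP.toℚᵘ-fromℚᵘ A)) ⟩
  toℚᵘ (+ 4 / 1) U.* toℚᵘ α   ≃⟨ UP.≃-sym (QP.toℚᵘ-homo-* (+ 4 / 1) α) ⟩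
  toℚᵘ ((+ 4 / 1) * α)        ∎)
  where
  open UP.≤-Reasoning
  A = U.mkℚᵘ a n
  B = U.mkℚᵘ b n
  α = a / suc n
  β = b / suc n
  -- the denominator of toℚᵘ 4 U.* A is 1 * (n + 1), which does not reduce to n + 1
  b²e≤4ae² : b ℤ.* b ℤ.* + (1 ℕ.* suc n) ℤ.≤ + 4 ℤ.* a ℤ.* (+ suc n ℤ.* + suc n)
  b²e≤4ae² = subst (λ k → b ℤ.* b ℤ.* + k ℤ.≤ + 4 ℤ.* a ℤ.* (+ suc n ℤ.* + suc n))
                   (sym (ℕP.*-identityˡ (suc n)))
                   (disc≤0⇒b²e≤4ae² a b (+ suc n) (ℤ.+≤+ ℕ.z≤n) Δ≤0)

Δ : ℚ → ℚ → ℚ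
Δ α β = (α + β) * (α + β) - (+ 7 / 1) * α - (+ 3 / 1) * β - (+ 7 / 4)

Δ-excess : ℚ → ℚ → ℚ
Δ-excess α β = (+ 1 / 2) * ((+ 4 / 1) * α - β * β) + (+ 1 / 2) * ((β + + 6 / 1) * (β + + 6 / 1))
             + (α + β - + 11 / 1) * (α + β + + 2 / 1)

Δ≡9/4+Δ-excess : ∀ α β → Δ α β ≡ + 9 / 4 + Δ-excess α β
Δ≡9/4+Δ-excess = solve 2 (λ α β →
    (α :+ β) :* (α :+ β) :- con (+ 7 / 1) :* α :- con (+ 3 / 1) :* β :- con (+ 7 / 4)
  := con (+ 9 / 4) :+ (con (+ 1 / 2) :* (con (+ 4 / 1) :* α :- β :* β)
                       :+ con (+ 1 / 2) :* ((β :+ con (+ 6 / 1)) :* (β :+ con (+ 6 / 1)))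
                       :+ (α :+ β :- con (+ 11 / 1)) :* (α :+ β :+ con (+ 2 / 1)))) refl
  where open +-*-Solver

0≤Δ-excess : ∀ α β → β * β ≤ (+ 4 / 1) * α → + 11 / 1 ≤ α + β → 0ℚ ≤ Δ-excess α β
0≤Δ-excess α β β²≤4α 11≤s =
  QP.+-mono-≤ (QP.+-mono-≤ (0≤p*q 0≤1/2 (p≤q⇒0≤q-p β²≤4α)) (0≤p*q 0≤1/2 (0≤p*p (β + + 6 / 1))))
              (0≤p*q (p≤q⇒0≤q-p 11≤s) 0≤s+2)
  where
  0≤1/2 : 0ℚ ≤ + 1 / 2
  0≤1/2 = toWitness {a? = 0ℚ QP.≤? + 1 / 2} tt
  0≤s+2 : 0ℚ ≤ α + β + + 2 / 1
  0≤s+2 = QP.≤-trans (toWitness {a? = 0ℚ QP.≤? + 13 / 1} tt) (QP.+-monoˡ-≤ (+ 2 / 1) 11≤s)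

1/4<Δ : ∀ α β → β * β ≤ (+ 4 / 1) * α → + 11 / 1 ≤ α + β → + 1 / 4 < Δ α β
1/4<Δ α β β²≤4α 11≤s = subst (+ 1 / 4 <_) (sym (Δ≡9/4+Δ-excess α β))
  (QP.+-mono-<-≤ (toWitness {a? = + 1 / 4 QP.<? + 9 / 4} tt) (0≤Δ-excess α β β²≤4α 11≤s))

lemma2p5 : (a b e : ℤ) → a ≢ + 0 → Data.Integer._<_ (+ 0) e
           → (∀ (j : ℕ) → Data.Integer._≤_ (+ 0) (h₂ a b e j))
           → let α = a /ℤ e
                 β = b /ℤ e
             in (+ 11 / 1) ≤ (α + β)
           → Data.Integer._≤_ (disc a b e) (+ 0)
           → (+ 1 / 4) < ((α + β) * (α + β) - (+ 7 / 1) * α - (+ 3 / 1) * β - (+ 7 / 4))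
lemma2p5 a b e _ 0<e _ 11≤α+β Δ≤0 = 1/4<Δ (a /ℤ e) (b /ℤ e) (disc≤0⇒β²≤4α a b e 0<e Δ≤0) 11≤α+β
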